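{- Let $f\in x+x^2\mathbb{C}[[x]]$ and let $\omega\in x+x^2\mathbb{C}[[x]]$ be the compositional inverse of $f(x)/f'(x)$. For $h\in\mathbb{C}[[x,s]]$ define $$(Kh)(x,s)=\frac{x}{\omega'(x)}\,\frac{\partial}{\partial x}\left[\frac{h(x,s)-h(s,s)}{x-s}\right]\in\mathbb{C}[[x,s]].$$ For $n\ge 0$ and $\varphi\in\mathbb{C}[[x]]$ (regarded as an element of $\mathbb{C}[[x,s]]$ not depending on $s$), set $T_n\varphi(s):=(K^n\varphi)(s,s)\in\mathbb{C}[[s]]$. Let $D=\frac{d}{ds}$ and let $\sigma$ denote the operator of multiplication by $\frac{s}{\omega'(s)}$ on $\mathbb{C}[[s]]$; products of operators below mean composition. Define operators $\alpha_i^{(n)}$ ($i,n\ge 0$) on $\mathbb{C}[[s]]$ recursively by $\alpha_0^{(0)}=1$, $\alpha_i^{(0)}=0$ for $i\ge1$, and $$\alpha_0^{(n+1)}=\sum_{i\ge 0}\frac{1}{(i+1)(i+2)}\,\alpha_i^{(n)}\sigma D^{i+2},\qquad \alpha_1^{(n+1)}=-\alpha_0^{(n)}\sigma D,\qquad \alpha_i^{(n+1)}=\frac1i\left(\alpha_{i-2}^{(n)}\sigma-\alpha_{i-1}^{(n)}\sigma D\right)\ (i\ge2)$$ (only finitely many $\alpha_i^{(n)}$ are nonzero for each $n$). Equivalently, $\alpha_i^{(n)}$ is the coefficient of $ED^i$ in $\nu^n(E)$, where $\nu$ is the map on expressions $\sum_i\alpha_iED^i$ (with coefficients $\alpha_i$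 noncommutative polynomials in $\sigma,D$) acting by $\alpha_iED^i\mapsto \alpha_i\big(\tfrac{1}{(i+1)(i+2)}\sigma D^{i+2}E-\tfrac{1}{i+1}\sigma DED^{i+1}+\tfrac1{i+2}\sigma ED^{i+2}\big)$, a term $cE$ being read as $cED^0$. Then for every $n\ge0$ and every $\varphi\in\mathbb{C}[[x]]$, $$T_n\varphi(s)=\alpha_0^{(n)}\varphi(s).$$ For instance $T_1=\tfrac12\sigma D^2$.
   Context: $\mathbb{C}[[x]]$, $\mathbb{C}[[x,s]]$ denote formal power series rings. The quotient $\frac{h(x,s)-h(s,s)}{x-s}$ is the (well-defined) divided difference in the first variable, an element of $\mathbb{C}[[x,s]]$; $1/\omega'(x)$ is well defined since $\omega'(0)=1$. -}

module Defs where

open import Level using (Level; _⊔_)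
open import Data.Nat using (ℕ; zero; suc; _∸_; _≟_)
open import Relation.Nullary using (yes; no)
open import Algebra.Bundles using (CommutativeRing)

module NatMul {c ℓ : Level} (R : CommutativeRing c ℓ) where
  open CommutativeRing R
  _·_ : ℕ → Carrier → Carrier
  zero  · x = 0#
  suc n · x = x + n · x

-- A ℚ-algebra: a commutative ring in which every positive integer is
-- invertible; inv n is the inverse of (n+1).  (Stand-in for ℂ.)
record QAlgebra (c ℓ : Level) : Set (Level.suc (c ⊔ ℓ)) where
  field
    cring    : CommutativeRing c ℓ
    inv      : ℕ → CommutativeRing.Carrier cring
    inv-spec : ∀ n → CommutativeRing._≈_ cring (NatMul._·_ cring (suc n) (inv n)) (CommutativeRing.1# cring)
  open CommutativeRing cring public
  open NatMul cring public

module PS {c ℓ : Level} (Q : QAlgebra c ℓ) where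
  open QAlgebra Q

  Σ< : ℕ → (ℕ → Carrier) → Carrier
  Σ< zero    f = 0#
  Σ< (suc n) f = Σ< n f + f n

  -- formal power series in one variable: n ↦ coefficient of x^n
  Series : Set c
  Series = ℕ → Carrier

  -- formal power series in two variables: i j ↦ coefficient of x^i s^j
  Series₂ : Set c
  Series₂ = ℕ → ℕ → Carrier

  infix 4 _≈ₛ_
  _≈ₛ_ : Series → Series → Set ℓ
  a ≈ₛ b = ∀ n → a n ≈ b n

  zeroS : Series
  zeroS _ = 0#

  oneS : Series
  oneS zero    = 1#
  oneS (suc _) = 0#

  X : Series
  X 1 = 1#
  X _ = 0#

  addS : Series → Series → Series
  addS a b n = a n + b n

  negS : Series → Series
  negS a n = - a n

  scaleS : Carrier → Series → Series
  scaleS r a n = r * a n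

  mulS : Series → Series → Series
  mulS a b n = Σ< (suc n) (λ k → a k * b (n ∸ k))

  powS : Series → ℕ → Series
  powS b zero    = oneS
  powS b (suc k) = mulS b (powS b k)

  -- composition a(b(x)), for b with zero constant term
  comp : Series → Series → Series
  comp a b n = Σ< (suc n) (λ k → a k * powS b k n)

  deriv : Series → Series
  deriv a n = suc n · a (suc n)

  -- multiplicative inverse of a series v with v 0 = 1:
  -- u 0 = 1,  u m = - Σ_{j<m} v (m-j) * u j
  recipApprox : Series → ℕ → Series
  recipApprox v zero k with k ≟ 0
  ... | yes _ = 1#
  ... | no  _ = 0#
  recipApprox v (suc n) k with k ≟ suc n
  ... | yes _ = - Σ< (suc n) (λ j → v (suc n ∸ j) * recipApprox v n j)
  ... | no  _ = recipApprox v n k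

  recip : Series → Series
  recip v k = recipApprox v k k

  fOverf' : Series → Series
  fOverf' f = mulS f (recip (deriv f))

  lift : Series → Series₂
  lift φ i zero    = φ i
  lift φ i (suc _) = 0#

  diag : Series₂ → Series
  diag h n = Σ< (suc n) (λ i → h i (n ∸ i))

  -- divided difference (h(x,s) - h(s,s)) / (x - s):
  -- coefficient of x^a s^m is Σ_{b≤m} h (a+b+1) (m-b)
  divDiff : Series₂ → Series₂
  divDiff h a m = Σ< (suc m) (λ b → h (suc (a Data.Nat.+ b)) (m ∸ b))

  derivX : Series₂ → Series₂
  derivX h i j = suc i · h (suc i) j

  mulX : Series → Series₂ → Series₂
  mulX p h i j = Σ< (suc i) (λ k → p k * h (i ∸ k) j)

  module WithOmega (ω : Series) where
    xOverω' : Series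
    xOverω' = mulS X (recip (deriv ω))

    K : Series₂ → Series₂
    K h = mulX xOverω' (derivX (divDiff h))

    Kⁿ : ℕ → Series₂ → Series₂
    Kⁿ zero    h = h
    Kⁿ (suc n) h = K (Kⁿ n h)

    T : ℕ → Series → Series
    T n φ = diag (Kⁿ n (lift φ))

    Op : Set c
    Op = Series → Series

    σ : Op
    σ = mulS xOverω'

    D : Op
    D = deriv

    Dⁿ : ℕ → Op
    Dⁿ zero    a = a
    Dⁿ (suc k) a = D (Dⁿ k a)

    addOp : Op → Op → Op
    addOp A B a = addS (A a) (B a)

    subOp : Op → Op → Op
    subOp A B a = addS (A a) (negS (B a))

    scaleOp : Carrier → Op → Op
    scaleOp r A a = scaleS r (A a)

    ΣOp : ℕ → (ℕ → Op) → Op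
    ΣOp zero    F a = zeroS
    ΣOp (suc n) F a = addS (ΣOp n F a) (F n a)

    -- α n i = α_i^{(n)}.  α_i^{(n)} = 0 for i > 2n, so the sum defining
    -- α_0^{(n+1)} is taken over i < 2n+1.
    α : ℕ → ℕ → Op
    α zero zero    a = a
    α zero (suc i) a = zeroS
    α (suc n) zero =
      ΣOp (suc (n Data.Nat.+ n))
        (λ i a → scaleS (inv (suc i) * inv i) (α n i (σ (Dⁿ (suc (suc i)) a))))
    α (suc n) (suc zero) a = negS (α n 0 (σ (D a)))
    α (suc n) (suc (suc k)) a =
      scaleS (inv (suc k)) (addS (α n k (σ a)) (negS (α n (suc k) (σ (D a)))))

module Submission where

-- For h ∈ C[[x,s]] write  jet j h := (∂ₛʲ h)(s,s) ∈ C[[s]], so that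
-- T_n φ = jet 0 (Kⁿ (lift φ)).  The proof rests on three rules that move
-- the building blocks of K past a jet (p is any series in x, Δ the
-- divided difference, D = d/ds):
--   (1) jet j (p(x)·g)  = p(s) · jet j g                       (jet-mulX)
--   (2) jet j (∂ₓ g)    = D (jet j g) − jet (j+1) g             (jet-derivX)
--   (3) (j+1)·jet j (Δh) = D^{j+1} (jet 0 h) − jet (j+1) h       (jet-divDiff)
-- (2) is the chain rule on the diagonal, (3) follows from (2) and the
-- identity ∂ₛ Δh = Δ(∂ₛh) + Δ(Δh) by induction on j.  Together they
-- express jet j (K h) through jet 0 h, jet (j+1) h, jet (j+2) h (jet-K).
-- Expanding K^{n+1} h = Kⁿ (K h) then gives, by induction on n,
--   jet 0 (Kⁿ h) = Σ_{i ≤ 2n} α_i^{(n)} (jet i h)                 (jet₀-Kⁿ)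
-- using 1/(i+1) − 1/(i+2) = 1/((i+1)(i+2)) and linearity of the α's.
-- For h = lift φ one has jet 0 h = φ and jet (i+1) h = 0, which yields
-- the theorem.

open import Defs
open import Level using (Level; _⊔_)
open import Data.Nat as ℕ using (ℕ; zero; suc; _∸_; _≤_; _<_; s≤s)
import Data.Nat.Properties as ℕP
open import Relation.Binary.PropositionalEquality as P using (_≡_)
open import Algebra.Bundles using (CommutativeRing)

-- Natural-number multiples n · x in a commutative ring.  Defs defines
-- _·_ by its own recursion; it coincides with the library's _×_, from
-- which the laws are inherited.
module NatMultiples {c ℓ : Level} (R : CommutativeRing c ℓ) where
  open CommutativeRing R
  open NatMul R
  import Algebra.Properties.Semiring.Mult semiring as SM
  import Algebra.Properties.CommutativeMonoid.Mult +-commutativeMonoid as CM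

  ·≡× : ∀ n x → n · x ≡ n SM.× x
  ·≡× zero x = P.refl
  ·≡× (suc n) x = P.cong (x +_) (·≡× n x)

  ·-cong : ∀ n {x y} → x ≈ y → n · x ≈ n · y
  ·-cong zero e = refl
  ·-cong (suc n) e = +-cong e (·-cong n e)

  ·-homo-+ : ∀ m n x → (m ℕ.+ n) · x ≈ m · x + n · x
  ·-homo-+ m n x rewrite ·≡× (m ℕ.+ n) x | ·≡× m x | ·≡× n x = SM.×-homo-+ x m n

  ·-distrib : ∀ n x y → n · (x + y) ≈ n · x + n · y
  ·-distrib n x y rewrite ·≡× n (x + y) | ·≡× n x | ·≡× n y = CM.×-distrib-+ x y n

  ·-assoc-* : ∀ n x y → (n · x) * y ≈ n · (x * y)
  ·-assoc-* n x y rewrite ·≡× n x | ·≡× n (x * y) = SM.×-assoc-* n x y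

  ·-comm-* : ∀ n x y → x * (n · y) ≈ n · (x * y)
  ·-comm-* n x y rewrite ·≡× n y | ·≡× n (x * y) = SM.×-comm-* n x y

  ·-assocˡ : ∀ m n x → m · (n · x) ≈ (m ℕ.* n) · x
  ·-assocˡ m n x rewrite ·≡× n x | ·≡× m (n SM.× x) | ·≡× (m ℕ.* n) x = SM.×-assocˡ x m n

  ·-zero : ∀ n → n · 0# ≈ 0#
  ·-zero zero = refl
  ·-zero (suc n) = trans (+-identityˡ _) (·-zero n)

module RingArithmetic {c ℓ : Level} (R : CommutativeRing c ℓ) where
  open CommutativeRing R
  open import Relation.Binary.Reasoning.Setoid setoid
  open import Algebra.Properties.Ring ring using (-‿distribˡ-*; -‿distribʳ-*)
  open import Algebra.Properties.AbelianGroup +-abelianGroup using (⁻¹-∙-comm)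
  open import Algebra.Properties.Group +-group using (⁻¹-involutive)
  open import Algebra.Properties.CommutativeSemigroup +-commutativeSemigroup
    using (interchange; x∙yz≈y∙xz) public

  -‿+ : ∀ x y → - (x + y) ≈ - x + - y
  -‿+ x y = sym (⁻¹-∙-comm x y)

  cancel-inner : ∀ x a b d → x + ((a + - b) + (d + - x)) ≈ (a + d) + - b
  cancel-inner x a b d = begin
    x + ((a + - b) + (d + - x)) ≈⟨ +-congˡ (interchange a (- b) d (- x)) ⟩
    x + ((a + d) + (- b + - x)) ≈⟨ x∙yz≈y∙xz x _ _ ⟩
    (a + d) + (x + (- b + - x)) ≈⟨ +-congˡ (x∙yz≈y∙xz x (- b) (- x)) ⟩
    (a + d) + (- b + (x + - x)) ≈⟨ +-congˡ (+-congˡ (-‿inverseʳ x)) ⟩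
    (a + d) + (- b + 0#)        ≈⟨ +-congˡ (+-identityʳ _) ⟩
    (a + d) + - b               ∎

  scaled-differences : ∀ r r' x y z →
    r * (x + - y) + - (r' * (x + - z)) ≈ (r + - r') * x + (r' * z + - (r * y))
  scaled-differences r r' x y z = begin
    r * (x + - y) + - (r' * (x + - z))
      ≈⟨ +-cong (trans (distribˡ r x (- y)) (+-congˡ (sym (-‿distribʳ-* r y))))
                (-‿cong (trans (distribˡ r' x (- z)) (+-congˡ (sym (-‿distribʳ-* r' z))))) ⟩
    (r * x + - (r * y)) + - (r' * x + - (r' * z))
      ≈⟨ +-congˡ (trans (-‿+ _ _) (+-congˡ (⁻¹-involutive _))) ⟩
    (r * x + - (r * y)) + (- (r' * x) + r' * z)
      ≈⟨ interchange _ _ _ _ ⟩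
    (r * x + - (r' * x)) + (- (r * y) + r' * z)
      ≈⟨ +-cong (trans (+-congˡ (-‿distribˡ-* r' x)) (sym (distribʳ x r (- r')))) (+-comm _ _) ⟩
    (r + - r') * x + (r' * z + - (r * y)) ∎

module Reciprocals {c ℓ : Level} (Q : QAlgebra c ℓ) where
  open QAlgebra Q
  open NatMultiples cring
  open import Relation.Binary.Reasoning.Setoid setoid

  inv-cancel : ∀ j x → inv j * (suc j · x) ≈ x
  inv-cancel j x = begin
    inv j * (suc j · x) ≈⟨ ·-comm-* (suc j) (inv j) x ⟩
    suc j · (inv j * x) ≈⟨ ·-assoc-* (suc j) (inv j) x ⟨
    (suc j · inv j) * x ≈⟨ *-congʳ (inv-spec j) ⟩
    1# * x              ≈⟨ *-identityˡ x ⟩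
    x                   ∎

  divide-by-suc : ∀ j {x y} → suc j · x ≈ y → x ≈ inv j * y
  divide-by-suc j {x} e = trans (sym (inv-cancel j x)) (*-congˡ e)

  inv-zero : inv 0 ≈ 1#
  inv-zero = trans (sym (+-identityʳ _)) (inv-spec 0)

  -- 1/(j+1) − 1/(j+2) = 1/((j+1)(j+2)): how the coefficients of α_0 arise
  inv-difference : ∀ j → inv j + - inv (suc j) ≈ inv (suc j) * inv j
  inv-difference j = begin
      inv j + - inv (suc j)                  ≈⟨ +-cong inv-j (-‿cong inv-sj) ⟩
      (q + suc j · q) + - (suc j · q)        ≈⟨ +-assoc _ _ _ ⟩
      q + (suc j · q + - (suc j · q))        ≈⟨ +-congˡ (-‿inverseʳ _) ⟩
      q + 0#                                 ≈⟨ +-identityʳ _ ⟩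
      q                                      ∎
    where
    q = inv (suc j) * inv j
    inv-j : inv j ≈ suc (suc j) · q
    inv-j = begin
      inv j                                ≈⟨ *-identityˡ _ ⟨
      1# * inv j                           ≈⟨ *-congʳ (inv-spec (suc j)) ⟨
      (suc (suc j) · inv (suc j)) * inv j  ≈⟨ ·-assoc-* (suc (suc j)) _ _ ⟩
      suc (suc j) · q                      ∎
    inv-sj : inv (suc j) ≈ suc j · q
    inv-sj = begin
      inv (suc j)                      ≈⟨ *-identityʳ _ ⟨
      inv (suc j) * 1#                 ≈⟨ *-congˡ (inv-spec j) ⟨
      inv (suc j) * (suc j · inv j)    ≈⟨ ·-comm-* (suc j) _ _ ⟩
      suc j · q                        ∎

module FiniteSums {c ℓ : Level} (Q : QAlgebra c ℓ) where
  open QAlgebra Q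
  open PS Q
  open NatMultiples cring
  open RingArithmetic cring
  open import Algebra.Properties.Ring ring using (-0#≈0#)
  open import Relation.Binary.Reasoning.Setoid setoid

  Σ-cong< : ∀ n {f g : ℕ → Carrier} → (∀ i → i < n → f i ≈ g i) → Σ< n f ≈ Σ< n g
  Σ-cong< zero e = refl
  Σ-cong< (suc n) e = +-cong (Σ-cong< n (λ i i<n → e i (ℕP.m<n⇒m<1+n i<n))) (e n ℕP.≤-refl)

  Σ-cong : ∀ n {f g : ℕ → Carrier} → (∀ i → f i ≈ g i) → Σ< n f ≈ Σ< n g
  Σ-cong n e = Σ-cong< n (λ i _ → e i)

  Σ-≡ : ∀ {m n} (f : ℕ → Carrier) → m ≡ n → Σ< m f ≈ Σ< n f
  Σ-≡ f P.refl = refl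

  Σ-+ : ∀ n (f g : ℕ → Carrier) → Σ< n (λ i → f i + g i) ≈ Σ< n f + Σ< n g
  Σ-+ zero f g = sym (+-identityˡ _)
  Σ-+ (suc n) f g = trans (+-congʳ (Σ-+ n f g)) (interchange _ _ _ _)

  Σ-* : ∀ n r (f : ℕ → Carrier) → Σ< n (λ i → r * f i) ≈ r * Σ< n f
  Σ-* zero r f = sym (zeroʳ r)
  Σ-* (suc n) r f = trans (+-congʳ (Σ-* n r f)) (sym (distribˡ r _ _))

  Σ-neg : ∀ n (f : ℕ → Carrier) → Σ< n (λ i → - f i) ≈ - Σ< n f
  Σ-neg zero f = sym -0#≈0#
  Σ-neg (suc n) f = trans (+-congʳ (Σ-neg n f)) (sym (-‿+ _ _))

  Σ-· : ∀ n k (f : ℕ → Carrier) → Σ< n (λ i → k · f i) ≈ k · Σ< n f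
  Σ-· zero k f = sym (·-zero k)
  Σ-· (suc n) k f = trans (+-congʳ (Σ-· n k f)) (sym (·-distrib k _ _))

  Σ-0 : ∀ n {f : ℕ → Carrier} → (∀ i → f i ≈ 0#) → Σ< n f ≈ 0#
  Σ-0 zero e = refl
  Σ-0 (suc n) e = trans (+-cong (Σ-0 n e) (e n)) (+-identityʳ 0#)

  Σ-const : ∀ n x → Σ< n (λ _ → x) ≈ n · x
  Σ-const zero x = refl
  Σ-const (suc n) x = trans (+-comm _ _) (+-congˡ (Σ-const n x))

  Σ-shift : ∀ n (f : ℕ → Carrier) → Σ< (suc n) f ≈ f 0 + Σ< n (λ i → f (suc i))
  Σ-shift zero f = trans (+-identityˡ _) (sym (+-identityʳ _))
  Σ-shift (suc n) f = trans (+-congʳ (Σ-shift n f)) (+-assoc _ _ _)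

  suc∸ : ∀ {k n} → k ≤ n → suc n ∸ k ≡ suc (n ∸ k)
  suc∸ k≤n = ℕP.+-∸-assoc 1 k≤n

  <s⇒≤ : ∀ {k n} → k < suc n → k ≤ n
  <s⇒≤ (s≤s p) = p

  Σ-triangle : ∀ N (G : ℕ → ℕ → Carrier) →
    Σ< N (λ i → Σ< (suc i) (λ k → G k (i ∸ k))) ≈ Σ< N (λ k → Σ< (N ∸ k) (G k))
  Σ-triangle zero G = refl
  Σ-triangle (suc N) G = begin
      Σ< N (λ i → Σ< (suc i) (λ k → G k (i ∸ k))) + Σ< (suc N) (λ k → G k (N ∸ k))
        ≈⟨ +-congʳ (Σ-triangle N G) ⟩
      Σ< N (λ k → Σ< (N ∸ k) (G k)) + (Σ< N (λ k → G k (N ∸ k)) + G N (N ∸ N))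
        ≈⟨ +-assoc _ _ _ ⟨
      (Σ< N (λ k → Σ< (N ∸ k) (G k)) + Σ< N (λ k → G k (N ∸ k))) + G N (N ∸ N)
        ≈⟨ +-cong (sym (Σ-+ N _ _))
                  (trans (reflexive (P.cong (G N) (ℕP.n∸n≡0 N))) (sym (+-identityˡ _))) ⟩
      Σ< N (λ k → Σ< (N ∸ k) (G k) + G k (N ∸ k)) + Σ< 1 (G N)
        ≈⟨ +-cong (Σ-cong< N (λ k k<N → Σ-≡ (G k) (P.sym (suc∸ (ℕP.<⇒≤ k<N)))))
                  (Σ-≡ (G N) (P.sym (ℕP.m+n∸n≡m 1 N))) ⟩
      Σ< N (λ k → Σ< (suc N ∸ k) (G k)) + Σ< (suc N ∸ N) (G N) ∎

  -- Σ_{b<N} Σ_{c<N−b} f(b+c) = Σ_{t<N} (t+1) f t: the index t is hit t+1 times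
  Σ-count : ∀ N (f : ℕ → Carrier) →
    Σ< N (λ b → Σ< (N ∸ b) (λ c' → f (b ℕ.+ c'))) ≈ Σ< N (λ t → suc t · f t)
  Σ-count N f = begin
    Σ< N (λ b → Σ< (N ∸ b) (λ c' → f (b ℕ.+ c')))
      ≈⟨ Σ-triangle N (λ b c' → f (b ℕ.+ c')) ⟨
    Σ< N (λ i → Σ< (suc i) (λ k → f (k ℕ.+ (i ∸ k))))
      ≈⟨ Σ-cong N (λ i → Σ-cong< (suc i) (λ k k<si →
           reflexive (P.cong f (ℕP.m+[n∸m]≡n (<s⇒≤ k<si))))) ⟩
    Σ< N (λ i → Σ< (suc i) (λ _ → f i))
      ≈⟨ Σ-cong N (λ i → Σ-const (suc i) (f i)) ⟩
    Σ< N (λ t → suc t · f t) ∎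

  -- Σ_{b≤m+1} b·v b + Σ_{b≤m+1} (m+1−b)·v b = (m+1)·Σ_{b≤m+1} v b,
  -- with the vanishing terms b = 0 and b = m+1 dropped on the left
  Σ-weights-complement : ∀ m (v : ℕ → Carrier) →
    Σ< (suc m) (λ t → suc t · v (suc t)) + Σ< (suc m) (λ b → (suc m ∸ b) · v b)
      ≈ suc m · Σ< (suc (suc m)) v
  Σ-weights-complement m v = begin
      Σ< (suc m) (λ t → suc t · v (suc t)) + Σ< (suc m) (λ b → (suc m ∸ b) · v b)
        ≈⟨ +-cong (trans (sym (+-identityˡ _)) (sym (Σ-shift (suc m) (λ b → b · v b))))
                  (trans (sym (+-identityʳ _))
                         (+-congˡ (sym (reflexive (P.cong (_· v (suc m)) (ℕP.n∸n≡0 (suc m))))))) ⟩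
      Σ< (suc (suc m)) (λ b → b · v b) + Σ< (suc (suc m)) (λ b → (suc m ∸ b) · v b)
        ≈⟨ Σ-+ (suc (suc m)) _ _ ⟨
      Σ< (suc (suc m)) (λ b → b · v b + (suc m ∸ b) · v b)
        ≈⟨ Σ-cong< (suc (suc m)) (λ b b< → trans (sym (·-homo-+ b (suc m ∸ b) (v b)))
               (reflexive (P.cong (_· v b) (ℕP.m+[n∸m]≡n (<s⇒≤ b<))))) ⟩
      Σ< (suc (suc m)) (λ b → suc m · v b)
        ≈⟨ Σ-· (suc (suc m)) (suc m) v ⟩
      suc m · Σ< (suc (suc m)) v ∎

  Σ-regroup : ∀ M (e g b t : ℕ → Carrier) → t 0 ≈ Σ< M e → t 1 ≈ - b 0 →
    (∀ i → t (suc (suc i)) ≈ g i + - b (suc i)) → b M ≈ 0# →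
    Σ< (suc (suc M)) t ≈ Σ< M (λ i → e i + (g i + - b i))
  Σ-regroup M e g b t t₀ t₁ t₂₊ bM = begin
      Σ< (suc (suc M)) t
        ≈⟨ Σ-shift (suc M) t ⟩
      t 0 + Σ< (suc M) (λ i → t (suc i))
        ≈⟨ +-cong t₀ (Σ-shift M (λ i → t (suc i))) ⟩
      Σ< M e + (t 1 + Σ< M (λ i → t (suc (suc i))))
        ≈⟨ +-congˡ (+-cong t₁ (trans (Σ-cong M t₂₊)
             (trans (Σ-+ M g (λ i → - b (suc i))) (+-congˡ (Σ-neg M (λ i → b (suc i))))))) ⟩
      Σ< M e + (- b 0 + (Σ< M g + - Σ< M (λ i → b (suc i))))
        ≈⟨ +-congˡ (trans (x∙yz≈y∙xz _ _ _) (+-congˡ (trans (sym (-‿+ _ _)) (-‿cong Σb)))) ⟩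
      Σ< M e + (Σ< M g + - Σ< M b)
        ≈⟨ trans (Σ-+ M e _) (+-congˡ (trans (Σ-+ M g _) (+-congˡ (Σ-neg M b)))) ⟨
      Σ< M (λ i → e i + (g i + - b i)) ∎
    where
    Σb : b 0 + Σ< M (λ i → b (suc i)) ≈ Σ< M b
    Σb = trans (sym (Σ-shift M b)) (trans (+-congˡ bM) (+-identityʳ _))

module Linear {c ℓ : Level} (Q : QAlgebra c ℓ) where
  open QAlgebra Q
  open PS Q
  open NatMultiples cring
  open RingArithmetic cring
  open FiniteSums Q
  open import Algebra.Properties.Ring ring using (-1*x≈-x; -‿distribʳ-*)
  open import Algebra.Properties.CommutativeSemigroup *-commutativeSemigroup
    using () renaming (x∙yz≈y∙xz to *-swap)

  subS : Series → Series → Series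
  subS a b = addS a (negS b)

  record Lin (A : Series → Series) : Set (c ⊔ ℓ) where
    field
      cong : ∀ {a b} → a ≈ₛ b → A a ≈ₛ A b
      add  : ∀ a b → A (addS a b) ≈ₛ addS (A a) (A b)
      scl  : ∀ r a → A (scaleS r a) ≈ₛ scaleS r (A a)

    neg : ∀ a → A (negS a) ≈ₛ negS (A a)
    neg a n = trans (cong {negS a} {scaleS (- 1#) a} (λ k → sym (-1*x≈-x (a k))) n)
                    (trans (scl (- 1#) a n) (-1*x≈-x _))

    zro : A zeroS ≈ₛ zeroS
    zro n = trans (cong {zeroS} {scaleS 0# zeroS} (λ k → sym (zeroˡ 0#)) n)
                  (trans (scl 0# zeroS n) (zeroˡ _))

    sub : ∀ a b → A (subS a b) ≈ₛ subS (A a) (A b)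
    sub a b n = trans (add a (negS b) n) (+-congˡ (neg b n))
  open Lin

  Lin-id : Lin (λ a → a)
  Lin-id = record { cong = λ e → e ; add = λ _ _ _ → refl ; scl = λ _ _ _ → refl }

  Lin-0 : Lin (λ _ → zeroS)
  Lin-0 = record { cong = λ _ _ → refl ; add = λ _ _ _ → sym (+-identityʳ 0#)
                 ; scl = λ r _ _ → sym (zeroʳ r) }

  Lin-∘ : ∀ {A B} → Lin A → Lin B → Lin (λ a → A (B a))
  Lin-∘ {A} {B} LA LB = record
    { cong = λ e → cong LA (cong LB e)
    ; add = λ a b n → trans (cong LA (add LB a b) n) (add LA (B a) (B b) n)
    ; scl = λ r a n → trans (cong LA (scl LB r a) n) (scl LA r (B a) n) }

  Lin-neg : ∀ {A} → Lin A → Lin (λ a → negS (A a))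
  Lin-neg {A} LA = record
    { cong = λ e n → -‿cong (cong LA e n)
    ; add = λ a b n → trans (-‿cong (add LA a b n)) (-‿+ _ _)
    ; scl = λ r a n → trans (-‿cong (scl LA r a n)) (-‿distribʳ-* r _) }

  Lin-scale : ∀ {A} r → Lin A → Lin (λ a → scaleS r (A a))
  Lin-scale {A} r LA = record
    { cong = λ e n → *-congˡ (cong LA e n)
    ; add = λ a b n → trans (*-congˡ (add LA a b n)) (distribˡ r _ _)
    ; scl = λ s a n → trans (*-congˡ (scl LA s a n)) (*-swap r s _) }

  Lin-add : ∀ {A B} → Lin A → Lin B → Lin (λ a → addS (A a) (B a))
  Lin-add {A} {B} LA LB = record
    { cong = λ e n → +-cong (cong LA e n) (cong LB e n)
    ; add = λ a b n → trans (+-cong (add LA a b n) (add LB a b n)) (interchange _ _ _ _)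
    ; scl = λ r a n → trans (+-cong (scl LA r a n) (scl LB r a n)) (sym (distribˡ r _ _)) }

  Lin-mulS : ∀ q → Lin (mulS q)
  Lin-mulS q = record
    { cong = λ e n → Σ-cong (suc n) (λ k → *-congˡ (e (n ∸ k)))
    ; add = λ a b n → trans (Σ-cong (suc n) (λ k → distribˡ (q k) _ _)) (Σ-+ (suc n) _ _)
    ; scl = λ r a n → trans (Σ-cong (suc n) (λ k → *-swap (q k) r _)) (Σ-* (suc n) r _) }

  Lin-deriv : Lin deriv
  Lin-deriv = record
    { cong = λ e n → ·-cong (suc n) (e (suc n))
    ; add = λ a b n → ·-distrib (suc n) _ _
    ; scl = λ r a n → sym (·-comm-* (suc n) r _) }

module Jets {c ℓ : Level} (Q : QAlgebra c ℓ) where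
  open QAlgebra Q
  open PS Q
  open NatMultiples cring
  open FiniteSums Q
  open Linear Q using (subS)
  open import Relation.Binary.Reasoning.Setoid setoid

  infix 4 _≈₂_
  _≈₂_ : Series₂ → Series₂ → Set ℓ
  h ≈₂ g = ∀ i j → h i j ≈ g i j

  _+₂_ : Series₂ → Series₂ → Series₂
  (h +₂ g) i j = h i j + g i j

  ∂s : Series₂ → Series₂
  ∂s h i j = suc j · h i (suc j)

  ∂sⁿ : ℕ → Series₂ → Series₂
  ∂sⁿ zero h = h
  ∂sⁿ (suc j) h = ∂sⁿ j (∂s h)

  jet : ℕ → Series₂ → Series
  jet j h = diag (∂sⁿ j h)

  ∂s-cong : ∀ {h g} → h ≈₂ g → ∂s h ≈₂ ∂s g
  ∂s-cong e i j = ·-cong (suc j) (e i (suc j))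

  ∂sⁿ-cong : ∀ j {h g} → h ≈₂ g → ∂sⁿ j h ≈₂ ∂sⁿ j g
  ∂sⁿ-cong zero e = e
  ∂sⁿ-cong (suc j) e = ∂sⁿ-cong j (∂s-cong e)

  diag-cong : ∀ {h g} → h ≈₂ g → diag h ≈ₛ diag g
  diag-cong e n = Σ-cong (suc n) (λ i → e i (n ∸ i))

  jet-cong : ∀ j {h g} → h ≈₂ g → jet j h ≈ₛ jet j g
  jet-cong j e = diag-cong (∂sⁿ-cong j e)

  ∂sⁿ-add : ∀ j h g → ∂sⁿ j (h +₂ g) ≈₂ ∂sⁿ j h +₂ ∂sⁿ j g
  ∂sⁿ-add zero h g i j = refl
  ∂sⁿ-add (suc j) h g i k =
    trans (∂sⁿ-cong j (λ i' j' → ·-distrib (suc j') _ _) i k) (∂sⁿ-add j (∂s h) (∂s g) i k)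

  jet-add : ∀ j h g → jet j (h +₂ g) ≈ₛ addS (jet j h) (jet j g)
  jet-add j h g n = trans (diag-cong (∂sⁿ-add j h g) n) (Σ-+ (suc n) _ _)

  ∂sⁿ-∂s : ∀ j h → ∂sⁿ j (∂s h) ≡ ∂s (∂sⁿ j h)
  ∂sⁿ-∂s zero h = P.refl
  ∂sⁿ-∂s (suc j) h = ∂sⁿ-∂s j (∂s h)

  ∂sⁿ-derivX : ∀ j g → ∂sⁿ j (derivX g) ≈₂ derivX (∂sⁿ j g)
  ∂sⁿ-derivX zero g i k = refl
  ∂sⁿ-derivX (suc j) g i k = trans (∂sⁿ-cong j ∂s-derivX i k) (∂sⁿ-derivX j (∂s g) i k)
    where
    ∂s-derivX : ∂s (derivX g) ≈₂ derivX (∂s g)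
    ∂s-derivX i j = begin
      suc j · (suc i · g (suc i) (suc j))  ≈⟨ ·-assocˡ (suc j) (suc i) _ ⟩
      (suc j ℕ.* suc i) · g (suc i) (suc j) ≈⟨ reflexive (P.cong (_· g (suc i) (suc j)) (ℕP.*-comm (suc j) (suc i))) ⟩
      (suc i ℕ.* suc j) · g (suc i) (suc j) ≈⟨ ·-assocˡ (suc i) (suc j) _ ⟨
      suc i · (suc j · g (suc i) (suc j))  ∎

  ∂sⁿ-mulX : ∀ j q g → ∂sⁿ j (mulX q g) ≈₂ mulX q (∂sⁿ j g)
  ∂sⁿ-mulX zero q g i k = refl
  ∂sⁿ-mulX (suc j) q g i k = trans (∂sⁿ-cong j ∂s-mulX i k) (∂sⁿ-mulX j q (∂s g) i k)
    where
    ∂s-mulX : ∂s (mulX q g) ≈₂ mulX q (∂s g)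
    ∂s-mulX i j = trans (sym (Σ-· (suc i) (suc j) _)) (Σ-cong (suc i) (λ k → sym (·-comm-* (suc j) _ _)))

  diag-chain-rule : ∀ g n → diag (derivX g) n + diag (∂s g) n ≈ suc n · diag g (suc n)
  diag-chain-rule g n =
    trans (+-congˡ (Σ-cong< (suc n) (λ i i< → reflexive
            (P.cong₂ _·_ (P.sym (suc∸ (<s⇒≤ i<))) (P.cong (g i) (P.sym (suc∸ (<s⇒≤ i<))))))))
          (Σ-weights-complement n (λ i → g i (suc n ∸ i)))

  ∂s-divDiff : ∀ h → ∂s (divDiff h) ≈₂ divDiff (∂s h) +₂ divDiff (divDiff h)
  ∂s-divDiff h a m = sym (trans (+-comm _ _) (trans (+-cong ΔΔ Δ∂s) (Σ-weights-complement m v)))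
    where
    v : ℕ → Carrier
    v b = h (suc (a ℕ.+ b)) (suc m ∸ b)
    ΔΔ : divDiff (divDiff h) a m ≈ Σ< (suc m) (λ t → suc t · v (suc t))
    ΔΔ = trans (Σ-cong< (suc m) (λ b b< → trans
              (Σ-cong (suc (m ∸ b)) (λ c' → reflexive (P.cong₂ h
                  (P.cong suc (P.trans (P.cong suc (ℕP.+-assoc a b c')) (P.sym (ℕP.+-suc a (b ℕ.+ c')))))
                  (ℕP.∸-+-assoc m b c'))))
              (Σ-≡ _ (P.sym (suc∸ (<s⇒≤ b<))))))
           (Σ-count (suc m) (λ t → v (suc t)))
    Δ∂s : divDiff (∂s h) a m ≈ Σ< (suc m) (λ b → (suc m ∸ b) · v b)
    Δ∂s = Σ-cong< (suc m) (λ b b< → reflexive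
            (P.cong₂ _·_ (P.sym (suc∸ (<s⇒≤ b<))) (P.cong (h (suc (a ℕ.+ b))) (P.sym (suc∸ (<s⇒≤ b<))))))

  diag-divDiff : ∀ h n → diag (divDiff h) n ≈ diag (derivX h) n
  diag-divDiff h n =
    trans (Σ-cong< (suc n) (λ a a< → trans
            (Σ-cong (suc (n ∸ a)) (λ b → reflexive (P.cong (h (suc (a ℕ.+ b))) (ℕP.∸-+-assoc n a b))))
            (Σ-≡ _ (P.sym (suc∸ (<s⇒≤ a<))))))
          (Σ-count (suc n) (λ t → h (suc t) (n ∸ t)))

  deriv-diag : ∀ h → addS (diag (∂s h)) (diag (divDiff h)) ≈ₛ deriv (diag h)
  deriv-diag h n = trans (+-comm _ _) (trans (+-congʳ (diag-divDiff h n)) (diag-chain-rule h n))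

  diag-mulX : ∀ q g n → diag (mulX q g) n ≈ mulS q (diag g) n
  diag-mulX q g n = begin
      Σ< (suc n) (λ i → Σ< (suc i) (λ k → q k * g (i ∸ k) (n ∸ i)))
        ≈⟨ Σ-cong< (suc n) (λ i i< → Σ-cong< (suc i) (λ k k< → *-congˡ (reflexive
              (P.cong (g (i ∸ k)) (P.sym (P.trans (ℕP.∸-+-assoc n k (i ∸ k))
                                      (P.cong (n ∸_) (ℕP.m+[n∸m]≡n (<s⇒≤ k<))))))))) ⟩
      Σ< (suc n) (λ i → Σ< (suc i) (λ k → G k (i ∸ k)))
        ≈⟨ Σ-triangle (suc n) G ⟩
      Σ< (suc n) (λ k → Σ< (suc n ∸ k) (G k))
        ≈⟨ Σ-cong< (suc n) (λ k k< → trans (Σ-≡ (G k) (suc∸ (<s⇒≤ k<))) (Σ-* (suc (n ∸ k)) (q k) _)) ⟩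
      mulS q (diag g) n ∎
    where
    G : ℕ → ℕ → Carrier
    G k i = q k * g i (n ∸ k ∸ i)

  jet-mulX : ∀ j q g → jet j (mulX q g) ≈ₛ mulS q (jet j g)
  jet-mulX j q g n = trans (diag-cong (∂sⁿ-mulX j q g) n) (diag-mulX q (∂sⁿ j g) n)

  jet-derivX : ∀ j g → jet j (derivX g) ≈ₛ subS (deriv (jet j g)) (jet (suc j) g)
  jet-derivX j g n = begin
      jet j (derivX g) n                                   ≈⟨ diag-cong (∂sⁿ-derivX j g) n ⟩
      diag (derivX G) n                                    ≈⟨ +-identityʳ _ ⟨
      diag (derivX G) n + 0#                               ≈⟨ +-congˡ (-‿inverseʳ _) ⟨
      diag (derivX G) n + (diag (∂s G) n + - diag (∂s G) n) ≈⟨ +-assoc _ _ _ ⟨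
      (diag (derivX G) n + diag (∂s G) n) + - diag (∂s G) n
        ≈⟨ +-cong (diag-chain-rule G n) (-‿cong (reflexive (P.cong (λ z → diag z n) (P.sym (∂sⁿ-∂s j g))))) ⟩
      deriv (jet j g) n + - jet (suc j) g n                ∎
    where
    G = ∂sⁿ j g

  jet-lift-zero : ∀ φ → jet 0 (lift φ) ≈ₛ φ
  jet-lift-zero φ k =
    trans (+-cong (trans (Σ-cong< k (λ i i<k → off-axis i i k i<k)) (Σ-0 k (λ _ → refl)))
                  (reflexive (P.cong (lift φ k) (ℕP.n∸n≡0 k))))
          (+-identityˡ _)
    where
    off-axis : ∀ a i k → i < k → lift φ a (k ∸ i) ≈ 0#
    off-axis a zero (suc k) _ = refl
    off-axis a (suc i) (suc k) (s≤s i<k) = off-axis a i k i<k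

  ∂sⁿ-vanish : ∀ j {h} → (∀ a b → h a b ≈ 0#) → ∀ a b → ∂sⁿ j h a b ≈ 0#
  ∂sⁿ-vanish zero h≈0 = h≈0
  ∂sⁿ-vanish (suc j) h≈0 = ∂sⁿ-vanish j (λ a b → trans (·-cong (suc b) (h≈0 a (suc b))) (·-zero (suc b)))

  jet-lift-suc : ∀ φ j → jet (suc j) (lift φ) ≈ₛ zeroS
  jet-lift-suc φ j k = Σ-0 (suc k) (λ i → ∂sⁿ-vanish j ∂s-lift i (k ∸ i))
    where
    ∂s-lift : ∀ a b → ∂s (lift φ) a b ≈ 0#
    ∂s-lift a b = ·-zero (suc b)

module Expansion {c ℓ : Level} (Q : QAlgebra c ℓ) (ω : PS.Series Q) where
  open QAlgebra Q
  open PS Q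
  open WithOmega ω
  open NatMultiples cring
  open RingArithmetic cring
  open Reciprocals Q
  open FiniteSums Q
  open Linear Q
  open Lin
  open Jets Q
  open import Algebra.Properties.Ring ring using (-‿distribʳ-*)
  open import Relation.Binary.Reasoning.Setoid setoid

  Lin-σ : Lin σ
  Lin-σ = Lin-mulS xOverω'

  Lin-Dⁿ : ∀ k → Lin (Dⁿ k)
  Lin-Dⁿ zero = Lin-id
  Lin-Dⁿ (suc k) = Lin-∘ Lin-deriv (Lin-Dⁿ k)

  Lin-ΣOp : ∀ m {F : ℕ → Op} → (∀ i → Lin (F i)) → Lin (ΣOp m F)
  Lin-ΣOp zero LF = Lin-0
  Lin-ΣOp (suc m) LF = Lin-add (Lin-ΣOp m LF) (LF m)

  Lin-α : ∀ n i → Lin (α n i)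
  Lin-α zero zero = Lin-id
  Lin-α zero (suc i) = Lin-0
  Lin-α (suc n) zero = Lin-ΣOp (suc (n ℕ.+ n)) (λ i →
      Lin-scale (inv (suc i) * inv i) (Lin-∘ (Lin-α n i) (Lin-∘ Lin-σ (Lin-Dⁿ (suc (suc i))))))
  Lin-α (suc n) (suc zero) = Lin-neg (Lin-∘ (Lin-α n 0) (Lin-∘ Lin-σ Lin-deriv))
  Lin-α (suc n) (suc (suc k)) = Lin-scale (inv (suc k))
      (Lin-add (Lin-∘ (Lin-α n k) Lin-σ) (Lin-neg (Lin-∘ (Lin-α n (suc k)) (Lin-∘ Lin-σ Lin-deriv))))

  α-vanish : ∀ n i → n ℕ.+ n < i → ∀ a → α n i a ≈ₛ zeroS
  α-vanish zero (suc i) _ a k = refl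
  α-vanish (suc n) (suc zero) (s≤s ()) a k
  α-vanish (suc n) (suc (suc i)) 2n+2<i+2 a k = begin
      inv (suc i) * (α n i (σ a) k + - α n (suc i) (σ (D a)) k)
        ≈⟨ *-congˡ (+-cong (α-vanish n i 2n<i (σ a) k)
                           (-‿cong (α-vanish n (suc i) (ℕP.m<n⇒m<1+n 2n<i) (σ (D a)) k))) ⟩
      inv (suc i) * (0# + - 0#) ≈⟨ *-congˡ (-‿inverseʳ 0#) ⟩
      inv (suc i) * 0#          ≈⟨ zeroʳ _ ⟩
      0#                        ∎
    where
    2n<i : n ℕ.+ n < i
    2n<i = ℕP.≤-pred (ℕP.≤-pred (P.subst (_< suc (suc i)) (ℕP.+-suc (suc n) n) 2n+2<i+2))

  Dⁿ-D : ∀ k a → Dⁿ k (D a) ≡ D (Dⁿ k a)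
  Dⁿ-D zero a = P.refl
  Dⁿ-D (suc k) a = P.cong D (Dⁿ-D k a)

  jet-divDiff : ∀ j h n →
    suc j · jet j (divDiff h) n ≈ subS (Dⁿ (suc j) (jet 0 h)) (jet (suc j) h) n
  jet-divDiff zero h n = trans (+-identityʳ _) (trans (diag-divDiff h n) (jet-derivX 0 h n))
  jet-divDiff (suc j) h n = begin
      x + suc j · x
        ≈⟨ +-congˡ (·-cong (suc j) (trans (jet-cong j (∂s-divDiff h) n)
                                          (jet-add j (divDiff (∂s h)) (divDiff (divDiff h)) n))) ⟩
      x + suc j · (y₁ + y₂)
        ≈⟨ +-congˡ (·-distrib (suc j) y₁ y₂) ⟩
      x + (suc j · y₁ + suc j · y₂)
        ≈⟨ +-congˡ (+-cong (jet-divDiff j (∂s h) n) (jet-divDiff j (divDiff h) n)) ⟩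
      x + ((A₁ + - jet (suc (suc j)) h n) + (A₂ + - x))
        ≈⟨ cancel-inner x A₁ _ A₂ ⟩
      (A₁ + A₂) + - jet (suc (suc j)) h n
        ≈⟨ +-congʳ Dⁿ-deriv-diag ⟩
      Dⁿ (suc (suc j)) (jet 0 h) n + - jet (suc (suc j)) h n ∎
    where
    x  = jet (suc j) (divDiff h) n
    y₁ = jet j (divDiff (∂s h)) n
    y₂ = jet j (divDiff (divDiff h)) n
    A₁ = Dⁿ (suc j) (jet 0 (∂s h)) n
    A₂ = Dⁿ (suc j) (jet 0 (divDiff h)) n
    Dⁿ-deriv-diag : A₁ + A₂ ≈ Dⁿ (suc (suc j)) (jet 0 h) n
    Dⁿ-deriv-diag = begin
      A₁ + A₂                                 ≈⟨ add (Lin-Dⁿ (suc j)) (diag (∂s h)) (diag (divDiff h)) n ⟨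
      Dⁿ (suc j) (addS (diag (∂s h)) (diag (divDiff h))) n
                                              ≈⟨ cong (Lin-Dⁿ (suc j)) (deriv-diag h) n ⟩
      Dⁿ (suc j) (D (diag h)) n               ≡⟨ P.cong (λ z → z n) (Dⁿ-D (suc j) (diag h)) ⟩
      Dⁿ (suc (suc j)) (jet 0 h) n            ∎

  jet-divDiff-solved : ∀ j h →
    jet j (divDiff h) ≈ₛ scaleS (inv j) (subS (Dⁿ (suc j) (jet 0 h)) (jet (suc j) h))
  jet-divDiff-solved j h n = divide-by-suc j (jet-divDiff j h n)

  jet-K : ∀ j h → jet j (K h) ≈ₛ
    σ (subS (D (scaleS (inv j) (subS (Dⁿ (suc j) (jet 0 h)) (jet (suc j) h))))
            (scaleS (inv (suc j)) (subS (Dⁿ (suc (suc j)) (jet 0 h)) (jet (suc (suc j)) h))))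
  jet-K j h n =
    trans (jet-mulX j xOverω' (derivX Δh) n)
      (trans (cong Lin-σ (jet-derivX j Δh) n)
             (cong Lin-σ (λ m → +-cong (cong Lin-deriv (jet-divDiff-solved j h) m)
                                       (-‿cong (jet-divDiff-solved (suc j) h m))) n))
    where Δh = divDiff h

  -- applying α_i^{(n)} to jet-K, using 1/(i+1) − 1/(i+2) = 1/((i+1)(i+2))
  α-jet-K : ∀ n i h k → α n i (jet i (K h)) k ≈
      (inv (suc i) * inv i) * α n i (σ (Dⁿ (suc (suc i)) (jet 0 h))) k
      + (inv (suc i) * α n i (σ (jet (suc (suc i)) h)) k
         + - (inv i * α n i (σ (D (jet (suc i) h))) k))
  α-jet-K n i h k = begin
      α n i (jet i (K h)) k
        ≈⟨ cong (Lin-α n i) (jet-K i h) k ⟩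
      L (subS (D (scaleS r (subS E F))) (scaleS r' (subS DE G))) k
        ≈⟨ sub Lασ (D (scaleS r (subS E F))) (scaleS r' (subS DE G)) k ⟩
      L (D (scaleS r (subS E F))) k + - L (scaleS r' (subS DE G)) k
        ≈⟨ +-cong (trans (scl LασD r (subS E F) k) (*-congˡ (sub LασD E F k)))
                  (-‿cong (trans (scl Lασ r' (subS DE G) k) (*-congˡ (sub Lασ DE G k)))) ⟩
      r * (L DE k + - L (D F) k) + - (r' * (L DE k + - L G k))
        ≈⟨ scaled-differences r r' (L DE k) (L (D F) k) (L G k) ⟩
      (r + - r') * L DE k + (r' * L G k + - (r * L (D F) k))
        ≈⟨ +-congʳ (*-congʳ (inv-difference i)) ⟩
      (r' * r) * L DE k + (r' * L G k + - (r * L (D F) k)) ∎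
    where
    L = λ a → α n i (σ a)
    Lασ = Lin-∘ (Lin-α n i) Lin-σ
    LασD = Lin-∘ Lασ Lin-deriv
    r = inv i
    r' = inv (suc i)
    E = Dⁿ (suc i) (jet 0 h)
    F = jet (suc i) h
    DE = Dⁿ (suc (suc i)) (jet 0 h)
    G = jet (suc (suc i)) h

  ΣOp-Σ : ∀ m (F : ℕ → Op) a k → ΣOp m F a k ≈ Σ< m (λ i → F i a k)
  ΣOp-Σ zero F a k = refl
  ΣOp-Σ (suc m) F a k = +-congʳ (ΣOp-Σ m F a k)

  -- K^{n+1} h = Kⁿ (K h): the expansion is proved by peeling K off first
  Kⁿ-K : ∀ n h → Kⁿ n (K h) ≡ K (Kⁿ n h)
  Kⁿ-K zero h = P.refl
  Kⁿ-K (suc n) h = P.cong K (Kⁿ-K n h)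

  jet₀-Kⁿ : ∀ n h k → jet 0 (Kⁿ n h) k ≈ Σ< (suc (n ℕ.+ n)) (λ i → α n i (jet i h) k)
  jet₀-Kⁿ zero h k = sym (+-identityˡ _)
  jet₀-Kⁿ (suc n) h k = begin
      jet 0 (K (Kⁿ n h)) k                         ≡⟨ P.cong (λ z → jet 0 z k) (P.sym (Kⁿ-K n h)) ⟩
      jet 0 (Kⁿ n (K h)) k                         ≈⟨ jet₀-Kⁿ n (K h) k ⟩
      Σ< M (λ i → α n i (jet i (K h)) k)           ≈⟨ Σ-cong M (λ i → α-jet-K n i h k) ⟩
      Σ< M (λ i → e i + (g i + - b i))             ≈⟨ Σ-regroup M e g b t t₀ t₁ t₂₊ bM ⟨
      Σ< (suc (suc M)) t                           ≡⟨ P.cong (λ m → Σ< (suc m) t) (P.sym (ℕP.+-suc (suc n) n)) ⟩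
      Σ< (suc (suc n ℕ.+ suc n)) t                 ∎
    where
    M = suc (n ℕ.+ n)
    t e g b : ℕ → Carrier
    t j = α (suc n) j (jet j h) k
    e i = (inv (suc i) * inv i) * α n i (σ (Dⁿ (suc (suc i)) (jet 0 h))) k
    g i = inv (suc i) * α n i (σ (jet (suc (suc i)) h)) k
    b i = inv i * α n i (σ (D (jet (suc i) h))) k
    t₀ : t 0 ≈ Σ< M e
    t₀ = ΣOp-Σ M _ (jet 0 h) k
    t₁ : t 1 ≈ - b 0
    t₁ = -‿cong (sym (trans (*-congʳ inv-zero) (*-identityˡ _)))
    t₂₊ : ∀ i → t (suc (suc i)) ≈ g i + - b (suc i)
    t₂₊ i = trans (distribˡ _ _ _) (+-congˡ (sym (-‿distribʳ-* _ _)))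
    bM : b M ≈ 0#
    bM = trans (*-congˡ (α-vanish n M ℕP.≤-refl (σ (D (jet (suc M) h))) k)) (zeroʳ _)

  -- for h = lift φ only the i = 0 term survives
  T≈α₀ : ∀ n φ → T n φ ≈ₛ α n 0 φ
  T≈α₀ n φ k = begin
      jet 0 (Kⁿ n (lift φ)) k
        ≈⟨ jet₀-Kⁿ n (lift φ) k ⟩
      Σ< (suc (n ℕ.+ n)) (λ i → α n i (jet i (lift φ)) k)
        ≈⟨ Σ-shift (n ℕ.+ n) _ ⟩
      α n 0 (jet 0 (lift φ)) k + Σ< (n ℕ.+ n) (λ i → α n (suc i) (jet (suc i) (lift φ)) k)
        ≈⟨ +-cong (cong (Lin-α n 0) (jet-lift-zero φ) k)
                  (Σ-0 (n ℕ.+ n) (λ i → trans (cong (Lin-α n (suc i)) (jet-lift-suc φ i) k)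
                                              (zro (Lin-α n (suc i)) k))) ⟩
      α n 0 φ k + 0#
        ≈⟨ +-identityʳ _ ⟩
      α n 0 φ k ∎

theorem1p1 : ∀ {c ℓ} (Q : QAlgebra c ℓ) →
    let open QAlgebra Q
        open PS Q
    in (f ω : Series) →
       f 0 ≈ 0# → f 1 ≈ 1# →
       ω 0 ≈ 0# → ω 1 ≈ 1# →
       comp (fOverf' f) ω ≈ₛ X → comp ω (fOverf' f) ≈ₛ X →
       ∀ (n : ℕ) (φ : Series) →
       WithOmega.T ω n φ ≈ₛ WithOmega.α ω n 0 φ
theorem1p1 Q f ω _ _ _ _ _ _ = Expansion.T≈α₀ Q ω
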